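{- Let $m$ and $n$ be positive integers with $n$ odd, let $d$ be a positive integer, and put $d'=nd-(n-1)/2$. Then $$\lambda_{mn}^{d'}\ \ge\ |\mathcal{S}_n|^m\,\lambda_m^{d}.$$
   Context: For integers $a\le b$, $[a,b]=\{a,\ldots,b\}$. A Langford sequence of order $m$ and defect $d$ is a sequence $(l_1,\ldots,l_{2m})$ of $2m$ integers such that for every $k\in[d,d+m-1]$ there are exactly two subscripts $i,j\in[1,2m]$ with $l_i=l_j=k$, and these satisfy $|i-j|=k$. $\lambda_M^{D}$ denotes the number of Langford sequences of order $M$ and defect $D$. $\mathcal{S}_n$ denotes the set of all digraphs $S$ with vertex set $[1,n]$ (loops allowed) such that every vertex has exactly one outgoing arc and exactly one incoming arc (a loop at a vertex counts as both), and such that the $n$ numbers $i+j$, for $(i,j)\in E(S)$ (a loop at $i$ giving $2i$), are pairwise distinct and form a set of $n$ consecutive integers. (These are the $1$-regular super edge-magic labeled digraphs of order $n$, with each vertex identified with its label.) -}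

module Defs where

open import Data.Nat using (ℕ; zero; suc; _+_; _*_; _≤_; _<_)
open import Data.Fin using (Fin; toℕ)
open import Data.Vec using (Vec; lookup)
open import Data.Bool using (Bool; true)
open import Data.Product using (Σ; ∃; _×_; ∃-syntax)
open import Data.Sum using (_⊎_)
open import Relation.Binary.PropositionalEquality using (_≡_)
open import Relation.Nullary using (¬_)

-- Langford sequences.
-- A sequence (l_1,...,l_{2m}) is a vector of length 2m, position p : Fin (2m)
-- standing for subscript toℕ p + 1 (so subscript differences are toℕ differences).

IsLangford : (m d : ℕ) → Vec ℕ (2 * m) → Set
IsLangford m d l =
  ∀ k → d ≤ k → k < d + m →
    ∃[ i ] ∃[ j ]
      ( ¬ (i ≡ j) × lookup l i ≡ k × lookup l j ≡ k × toℕ j ≡ toℕ i + k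
      × (∀ p → lookup l p ≡ k → (p ≡ i ⊎ p ≡ j)) )

-- Langford sequences of order m and defect d; the property is irrelevant,
-- so two such sequences are equal iff their underlying vectors are.
record Langford (m d : ℕ) : Set where
  constructor mkLangford
  field
    seq        : Vec ℕ (2 * m)
    .isLangford : IsLangford m d seq

-- 1-regular super edge-magic labeled digraphs of order n.
-- Vertex v : Fin n carries label toℕ v + 1; a digraph (loops allowed) is an
-- adjacency matrix A, with an arc (u,v) iff A[u][v] ≡ true.

Arc : {n : ℕ} → Vec (Vec Bool n) n → Fin n → Fin n → Set
Arc A u v = lookup (lookup A u) v ≡ true

arcSum : {n : ℕ} → Fin n → Fin n → ℕ
arcSum u v = (toℕ u + 1) + (toℕ v + 1)

IsSEM1Reg : (n : ℕ) → Vec (Vec Bool n) n → Set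
IsSEM1Reg n A =
  (∀ u → ∃[ v ] (Arc A u v × (∀ w → Arc A u w → w ≡ v)))
  × (∀ v → ∃[ u ] (Arc A u v × (∀ w → Arc A w v → w ≡ u)))
  × (∀ u v u′ v′ → Arc A u v → Arc A u′ v′ → arcSum u v ≡ arcSum u′ v′ →
       (u ≡ u′ × v ≡ v′))
  × ∃[ s ] ( (∀ u v → Arc A u v → (s ≤ arcSum u v × arcSum u v < s + n))
           × (∀ t → s ≤ t → t < s + n → ∃[ u ] ∃[ v ] (Arc A u v × arcSum u v ≡ t)) )

-- the set 𝒮_n (elements equal iff adjacency matrices are equal)
record SEM (n : ℕ) : Set where
  constructor mkSEM
  field
    adj      : Vec (Vec Bool n) n
    .isSEM   : IsSEM1Reg n adj

module Submission where

-- Proof: an injective "product" (S_0, …, S_{m-1}) , L ↦ L′ from m-tuples of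
-- 1-regular super edge-magic digraphs of order n and Langford sequences of
-- order m and defect d to Langford sequences of order mn and defect nd - h.
-- Every entry k of L is replaced by a block of n entries taken from
-- [nk - h, nk + h]; the first occurrence of k and the second one use two
-- different arrangements of this block, read off the digraph S_{k-d}.

open import Defs
open import Data.Nat using (ℕ; zero; suc; _+_; _*_; _∸_; _^_; _≤_; _<_; s≤s; _≤?_; _<?_; NonZero; >-nonZero)
open import Data.Nat.Properties
open import Data.Nat.DivMod
  using (_/_; _%_; _mod_; m≡m%n+[m/n]*n; m*n/n≡m; /-monoˡ-≤; m<n*o⇒m/o<n; +-distrib-/-∣ˡ; m<n⇒m/n≡0; m<n⇒m%n≡m)
open import Data.Nat.Divisibility using (m∣m*n)
open import Data.Nat.Tactic.RingSolver using (solve-∀)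
open import Data.Fin using (Fin; toℕ; fromℕ<; opposite; cast; combine; remQuot; finToFun; funToFin)
  renaming (zero to fzero; suc to fsuc)
open import Data.Fin.Properties
  using (any?; toℕ-injective; toℕ-fromℕ<; toℕ<n; toℕ≤pred[n]; toℕ-cast; toℕ-combine; cast-involutive;
         remQuot-combine; combine-remQuot; funToFin-finToFin; injective⇒≤; opposite-prop; opposite-involutive)
  renaming (_≟_ to _≟ᶠ_)
open import Data.Fin.Permutation using (Permutation; permutation)
open import Data.Vec using (Vec; lookup; tabulate)
open import Data.Vec.Properties using (lookup∘tabulate; tabulate∘lookup; tabulate-cong; ≡-dec)
open import Data.Bool using (Bool; true; false)
open import Data.Bool.Properties using () renaming (_≟_ to _≟ᵇ_)
open import Data.Product using (Σ; ∃; _×_; ∃-syntax; _,_; proj₁; proj₂; uncurry)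
open import Data.Sum using (_⊎_; inj₁; inj₂)
open import Data.Empty using (⊥-elim)
open import Function using (_∘_)
open import Function.Bundles using (_↔_; Inverse)
open import Relation.Nullary using (¬_; Dec; yes; no)
open import Relation.Nullary.Decidable using (recompute; _×-dec_)
open import Relation.Binary.PropositionalEquality hiding (J)
import Algebra.Properties.CommutativeMonoid.Sum as CommutativeMonoidSum

open CommutativeMonoidSum +-0-commutativeMonoid using (sum; sum-permute; ∑-distrib-+; sum-cong-≗)

left-inverse⇒injective : ∀ {A B : Set} {f : A → B} (g : B → A) → (∀ x → g (f x) ≡ x) →
                         ∀ {x y} → f x ≡ f y → x ≡ y
left-inverse⇒injective {f = f} g g∘f {x} {y} e = trans (sym (g∘f x)) (trans (cong g e) (g∘f y))

bool-ext : ∀ (x y : Bool) → (x ≡ true → y ≡ true) → (y ≡ true → x ≡ true) → x ≡ y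
bool-ext true  _     x⇒y _   = sym (x⇒y refl)
bool-ext false true  _   y⇒x = y⇒x refl
bool-ext false false _   _   = refl

lookup-extensional : ∀ {A : Set} {L} (xs ys : Vec A L) → (∀ i → lookup xs i ≡ lookup ys i) → xs ≡ ys
lookup-extensional xs ys eq = trans (sym (tabulate∘lookup xs)) (trans (tabulate-cong eq) (tabulate∘lookup ys))

quotient-of : ∀ n .{{_ : NonZero n}} k x → x < n → (n * k + x) / n ≡ k
quotient-of n k x x<n = begin
  (n * k + x) / n      ≡⟨ +-distrib-/-∣ˡ x (m∣m*n k) ⟩
  n * k / n + x / n    ≡⟨ cong₂ _+_ (trans (cong (_/ n) (*-comm n k)) (m*n/n≡m k n)) (m<n⇒m/n≡0 x<n) ⟩
  k + 0                ≡⟨ +-identityʳ k ⟩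
  k                    ∎
  where open ≡-Reasoning

sum-const : ∀ n c → sum {n} (λ _ → c) ≡ n * c
sum-const zero    c = refl
sum-const (suc n) c = cong (c +_) (sum-const n c)

-- Gauss: pairing i with its opposite k - i shows  2 · (0 + 1 + ⋯ + k) = (k + 1) k
sum-toℕ : ∀ k → 2 * sum {suc k} toℕ ≡ suc k * k
sum-toℕ k = begin
  2 * Σi                                       ≡⟨ cong (Σi +_) (+-identityʳ Σi) ⟩
  Σi + Σi                                      ≡⟨ cong (Σi +_) (sum-permute toℕ reversal) ⟩
  Σi + sum {suc k} (toℕ ∘ opposite)            ≡⟨ ∑-distrib-+ {suc k} toℕ (toℕ ∘ opposite) ⟨
  sum {suc k} (λ i → toℕ i + toℕ (opposite i)) ≡⟨ sum-cong-≗ i+opposite ⟩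
  sum {suc k} (λ _ → k)                        ≡⟨ sum-const (suc k) k ⟩
  suc k * k                                    ∎
  where
  open ≡-Reasoning
  Σi : ℕ
  Σi = sum {suc k} toℕ
  reversal : Permutation (suc k) (suc k)
  reversal = permutation opposite opposite opposite-involutive opposite-involutive
  i+opposite : ∀ (i : Fin (suc k)) → toℕ i + toℕ (opposite i) ≡ k
  i+opposite i = trans (cong (toℕ i +_) (opposite-prop i)) (m+[n∸m]≡n (toℕ≤pred[n] i))

funToFin-cong : ∀ {m b} {f g : Fin m → Fin b} → (∀ q → f q ≡ g q) → funToFin f ≡ funToFin g
funToFin-cong {zero}  _    = refl
funToFin-cong {suc m} same = cong₂ combine (same fzero) (funToFin-cong (same ∘ fsuc))

finToFun-injective : ∀ {m b} {x y : Fin (b ^ m)} → (∀ q → finToFun x q ≡ finToFun y q) → x ≡ y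
finToFun-injective {m} {b} {x} {y} same =
  trans (sym (funToFin-finToFin {m} {b} x)) (trans (funToFin-cong {m} {b} same) (funToFin-finToFin {m} {b} y))

count-by-injection : ∀ {A B C : Set} {a b c m} → Fin a ↔ A → Fin b ↔ B → Fin c ↔ C →
  (F : (Fin m → B) → C → A) → (∀ f g x y → F f x ≡ F g y → (∀ q → f q ≡ g q) × x ≡ y) →
  b ^ m * c ≤ a
count-by-injection {A} {B} {C} {a} {b} {c} {m} ia ib ic F F-injective = injective⇒≤ {f = φ} φ-injective
  where
  open Inverse
  -- w ∈ Fin (bᵐ c) encodes m digits in Fin b and a remainder in Fin c
  digits : Fin (b ^ m * c) → Fin m → B
  digits w = to ib ∘ finToFun (proj₁ (remQuot {b ^ m} c w))
  rest : Fin (b ^ m * c) → C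
  rest w = to ic (proj₂ (remQuot {b ^ m} c w))
  φ : Fin (b ^ m * c) → Fin a
  φ w = from ia (F (digits w) (rest w))
  φ-injective : ∀ {w w′} → φ w ≡ φ w′ → w ≡ w′
  φ-injective {w} {w′} e =
    trans (sym (combine-remQuot {b ^ m} c w))
      (trans (cong₂ combine (finToFun-injective {m} {b} λ q → left-inverse⇒injective (from ib) (strictlyInverseʳ ib) (proj₁ same q))
                            (left-inverse⇒injective (from ic) (strictlyInverseʳ ic) (proj₂ same)))
             (combine-remQuot {b ^ m} c w′))
    where
    same : (∀ q → digits w q ≡ digits w′ q) × rest w ≡ rest w′
    same = F-injective _ _ _ _ (left-inverse⇒injective (to ia) (strictlyInverseˡ ia) e)

IsFirst : ∀ {L} → Vec ℕ L → Fin L → Set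
IsFirst l p = ∃[ q ] (toℕ q ≡ toℕ p + lookup l p × lookup l q ≡ lookup l p)

IsSecond : ∀ {L} → Vec ℕ L → Fin L → Set
IsSecond l p = ∃[ q ] (toℕ p ≡ toℕ q + lookup l p × lookup l q ≡ lookup l p)

isFirst? : ∀ {L} (l : Vec ℕ L) p → Dec (IsFirst l p)
isFirst? l p = any? λ q → (toℕ q ≟ toℕ p + lookup l p) ×-dec (lookup l q ≟ lookup l p)

isSecond? : ∀ {L} (l : Vec ℕ L) p → Dec (IsSecond l p)
isSecond? l p = any? λ q → (toℕ p ≟ toℕ q + lookup l p) ×-dec (lookup l q ≟ lookup l p)

record Occurrences {L} (l : Vec ℕ L) (k : ℕ) : Set where
  field
    left right   : Fin L
    at-left      : lookup l left ≡ k
    at-right     : lookup l right ≡ k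
    distance     : toℕ right ≡ toℕ left + k
    only         : ∀ p → lookup l p ≡ k → p ≡ left ⊎ p ≡ right

occurrences : ∀ {m d l k} → IsLangford m d l → d ≤ k → k < d + m → Occurrences l k
occurrences LP d≤k k<d+m with LP _ d≤k k<d+m
... | i , j , _ , li , lj , dist , only = record
  { left = i ; right = j ; at-left = li ; at-right = lj ; distance = dist ; only = only }

module OccurrenceFacts {L} {l : Vec ℕ L} {k} (O : Occurrences l k) (1≤k : 1 ≤ k) where
  open Occurrences O

  left≤right : toℕ left ≤ toℕ right
  left≤right = subst (toℕ left ≤_) (sym distance) (m≤m+n (toℕ left) k)

  between : ∀ q → lookup l q ≡ k → toℕ left ≤ toℕ q × toℕ q ≤ toℕ right
  between q lq with only q lq
  ... | inj₁ refl = ≤-refl , left≤right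
  ... | inj₂ refl = left≤right , ≤-refl

  left-isFirst : IsFirst l left
  left-isFirst = right , trans distance (cong (toℕ left +_) (sym at-left)) , trans at-right (sym at-left)

  right-isSecond : IsSecond l right
  right-isSecond = left , trans distance (cong (toℕ left +_) (sym at-right)) , trans at-left (sym at-right)

  -- a partner k places beyond an occurrence would be a third occurrence
  no-partner-right : ∀ p → lookup l p ≡ k → IsFirst l p → toℕ p < toℕ right
  no-partner-right p lp (q , q≡ , lq) = begin-strict
    toℕ p        <⟨ m<m+n (toℕ p) 1≤k ⟩
    toℕ p + k    ≡⟨ trans (cong (toℕ p +_) (sym lp)) (sym q≡) ⟩
    toℕ q        ≤⟨ proj₂ (between q (trans lq lp)) ⟩
    toℕ right   ∎
    where open ≤-Reasoning

  no-partner-left : ∀ p → lookup l p ≡ k → IsSecond l p → toℕ left < toℕ p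
  no-partner-left p lp (q , p≡ , lq) = begin-strict
    toℕ left    ≤⟨ proj₁ (between q (trans lq lp)) ⟩
    toℕ q        <⟨ m<m+n (toℕ q) 1≤k ⟩
    toℕ q + k    ≡⟨ trans (cong (toℕ q +_) (sym lp)) (sym p≡) ⟩
    toℕ p        ∎
    where open ≤-Reasoning

  isFirst⇒left : ∀ p → lookup l p ≡ k → IsFirst l p → p ≡ left
  isFirst⇒left p lp fp with only p lp
  ... | inj₁ p≡left = p≡left
  ... | inj₂ refl = ⊥-elim (<-irrefl refl (no-partner-right p lp fp))

  isSecond⇒right : ∀ p → lookup l p ≡ k → IsSecond l p → p ≡ right
  isSecond⇒right p lp sp with only p lp
  ... | inj₂ p≡right = p≡right
  ... | inj₁ refl = ⊥-elim (<-irrefl refl (no-partner-left p lp sp))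

  right-notFirst : ¬ IsFirst l right
  right-notFirst fr = <-irrefl refl (no-partner-right right at-right fr)

module Blocks (h : ℕ) where

  n : ℕ
  n = suc (2 * h)

  block : ℕ → Fin n → ℕ
  block k x = n * k ∸ h + toℕ x

  -- for k ≥ 1 the subtraction in a block is exact, and the block is positive
  h<n*k : ∀ {k} → 1 ≤ k → h < n * k
  h<n*k {k} 1≤k = ≤-trans (s≤s (m≤m+n h (h + 0))) (m≤m*n n k)
    where instance _ = >-nonZero 1≤k

  h≤n*k : ∀ {k} → 1 ≤ k → h ≤ n * k
  h≤n*k 1≤k = <⇒≤ (h<n*k 1≤k)

  block-positive : ∀ {k} x → 1 ≤ k → 1 ≤ block k x
  block-positive {k} x 1≤k = ≤-trans (m<n⇒0<n∸m (h<n*k 1≤k)) (m≤m+n (n * k ∸ h) (toℕ x))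

  block+h : ∀ {k} x → 1 ≤ k → block k x + h ≡ n * k + toℕ x
  block+h {k} x 1≤k = begin
    n * k ∸ h + toℕ x + h    ≡⟨ +-assoc (n * k ∸ h) (toℕ x) h ⟩
    n * k ∸ h + (toℕ x + h)  ≡⟨ cong (n * k ∸ h +_) (+-comm (toℕ x) h) ⟩
    n * k ∸ h + (h + toℕ x)  ≡⟨ +-assoc (n * k ∸ h) h (toℕ x) ⟨
    n * k ∸ h + h + toℕ x    ≡⟨ cong (_+ toℕ x) (m∸n+n≡m (h≤n*k 1≤k)) ⟩
    n * k + toℕ x            ∎
    where open ≡-Reasoning

  block-symbol : ∀ {k} x → 1 ≤ k → (block k x + h) / n ≡ k
  block-symbol {k} x 1≤k = trans (cong (_/ n) (block+h x 1≤k)) (quotient-of n k (toℕ x) (toℕ<n x))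

  block-injective : ∀ {k k′ x x′} → 1 ≤ k → 1 ≤ k′ → block k x ≡ block k′ x′ → k ≡ k′ × x ≡ x′
  block-injective {k} {k′} {x} {x′} 1≤k 1≤k′ e = k≡k′ , toℕ-injective x≡x′
    where
    k≡k′ : k ≡ k′
    k≡k′ = trans (sym (block-symbol x 1≤k)) (trans (cong (λ v → (v + h) / n) e) (block-symbol x′ 1≤k′))
    x≡x′ : toℕ x ≡ toℕ x′
    x≡x′ = +-cancelˡ-≡ (n * k ∸ h) _ _ (trans e (cong (λ j → block j x′) (sym k≡k′)))

  block<ceiling : ∀ {c k} x → k < c → block k x < n * c
  block<ceiling {c} {k} x k<c = begin-strict
    n * k ∸ h + toℕ x  ≤⟨ +-monoˡ-≤ (toℕ x) (m∸n≤m (n * k) h) ⟩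
    n * k + toℕ x      <⟨ +-monoʳ-< (n * k) (toℕ<n x) ⟩
    n * k + n          ≡⟨ +-comm (n * k) n ⟩
    n + n * k          ≡⟨ *-suc n k ⟨
    n * suc k          ≤⟨ *-monoʳ-≤ n k<c ⟩
    n * c              ∎
    where open ≤-Reasoning

  block-cover : ∀ {d m K} → 1 ≤ d → n * d ∸ h ≤ K → K < n * d ∸ h + m * n →
                Σ ℕ λ k → Σ (Fin n) λ x → d ≤ k × k < d + m × K ≡ block k x
  block-cover {d} {m} {K} 1≤d lo hi = k , x , d≤k , k<d+m , K≡block
    where
    k : ℕ
    k = (K + h) / n
    x : Fin n
    x = (K + h) mod n
    d*n≤K+h : d * n ≤ K + h
    d*n≤K+h = subst (_≤ K + h) (trans (m∸n+n≡m (h≤n*k 1≤d)) (*-comm n d)) (+-monoˡ-≤ h lo)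
    K+h< : K + h < (d + m) * n
    K+h< = begin-strict
      K + h                    <⟨ +-monoˡ-< h hi ⟩
      n * d ∸ h + m * n + h    ≡⟨ right-comm (n * d ∸ h) (m * n) h ⟩
      n * d ∸ h + h + m * n    ≡⟨ cong (_+ m * n) (m∸n+n≡m (h≤n*k 1≤d)) ⟩
      n * d + m * n            ≡⟨ collect n d m ⟩
      (d + m) * n              ∎
      where
      open ≤-Reasoning
      right-comm : ∀ a b c → a + b + c ≡ a + c + b
      right-comm = solve-∀
      collect : ∀ n d m → n * d + m * n ≡ (d + m) * n
      collect = solve-∀
    d≤k : d ≤ k
    d≤k = subst (_≤ k) (m*n/n≡m d n) (/-monoˡ-≤ n d*n≤K+h)
    k<d+m : k < d + m
    k<d+m = m<n*o⇒m/o<n K+h<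
    K≡block : K ≡ block k x
    K≡block = +-cancelʳ-≡ h K (block k x) (begin
      K + h                    ≡⟨ m≡m%n+[m/n]*n (K + h) n ⟩
      (K + h) % n + k * n      ≡⟨ +-comm _ (k * n) ⟩
      k * n + (K + h) % n      ≡⟨ cong₂ _+_ (*-comm k n) (sym (toℕ-fromℕ< _)) ⟩
      n * k + toℕ x            ≡⟨ block+h x (≤-trans 1≤d d≤k) ⟨
      block k x + h            ∎)
      where open ≡-Reasoning

  block-distance : ∀ {k} i (a b t : Fin n) → 1 ≤ k → toℕ b + h ≡ toℕ a + toℕ t →
                   n * (i + k) + toℕ b ≡ (n * i + toℕ a) + block k t
  block-distance {k} i a b t 1≤k rel = +-cancelʳ-≡ h _ _ (begin
    n * (i + k) + toℕ b + h              ≡⟨ regroup₁ n i k (toℕ b) h ⟩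
    n * i + n * k + (toℕ b + h)          ≡⟨ cong (n * i + n * k +_) rel ⟩
    n * i + n * k + (toℕ a + toℕ t)      ≡⟨ regroup₂ (n * i) (n * k) (toℕ a) (toℕ t) ⟩
    (n * i + toℕ a) + (n * k + toℕ t)    ≡⟨ cong ((n * i + toℕ a) +_) (block+h t 1≤k) ⟨
    (n * i + toℕ a) + (block k t + h)    ≡⟨ +-assoc (n * i + toℕ a) (block k t) h ⟨
    (n * i + toℕ a) + block k t + h      ∎)
    where
    open ≡-Reasoning
    regroup₁ : ∀ n i k b h → n * (i + k) + b + h ≡ n * i + n * k + (b + h)
    regroup₁ = solve-∀
    regroup₂ : ∀ p q a t → p + q + (a + t) ≡ (p + a) + (q + t)
    regroup₂ = solve-∀

  -- A block pattern prescribes how the two blocks replacing the two occurrences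
  -- of a symbol k are filled: offset r of the first block receives offset
  -- first r, offset r of the second block receives second r.  Every offset t
  -- is used once in each block, at offsets a and b with  b + h = a + t, so that
  -- (by block-distance) the two copies of  block k t  are  block k t  apart.
  record BlockPattern : Set where
    field
      first second     : Fin n → Fin n
      first-injective  : ∀ {r r′} → first r ≡ first r′ → r ≡ r′
      second-injective : ∀ {r r′} → second r ≡ second r′ → r ≡ r′
      realise          : ∀ t → Σ (Fin n) λ a → Σ (Fin n) λ b →
                           first a ≡ t × second b ≡ t × toℕ b + h ≡ toℕ a + toℕ t

module BlowUp (h m d : ℕ) (1≤d : 1 ≤ d) where
  open Blocks h
  open BlockPattern

  D′ : ℕ
  D′ = n * d ∸ h

  ceiling : ℕ
  ceiling = n * (d + m)

  InRange : ℕ → Set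
  InRange k = d ≤ k × k < d + m

  inRange? : ∀ k → Dec (InRange k)
  inRange? k = (d ≤? k) ×-dec (k <? d + m)

  pos : Fin (2 * m) → Fin n → Fin (2 * (m * n))
  pos p r = cast (*-assoc 2 m n) (combine p r)

  unpos : Fin (2 * (m * n)) → Fin (2 * m) × Fin n
  unpos P = remQuot n (cast (sym (*-assoc 2 m n)) P)

  toℕ-pos : ∀ p r → toℕ (pos p r) ≡ n * toℕ p + toℕ r
  toℕ-pos p r = trans (toℕ-cast (*-assoc 2 m n) (combine p r)) (toℕ-combine p r)

  unpos-pos : ∀ p r → unpos (pos p r) ≡ (p , r)
  unpos-pos p r = trans (cong (remQuot n) (cast-involutive (sym (*-assoc 2 m n)) (*-assoc 2 m n) (combine p r)))
                        (remQuot-combine p r)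

  pos-unpos : ∀ P → uncurry pos (unpos P) ≡ P
  pos-unpos P = trans (cong (cast (*-assoc 2 m n)) (combine-remQuot {2 * m} n (cast (sym (*-assoc 2 m n)) P)))
                      (cast-involutive (*-assoc 2 m n) (sym (*-assoc 2 m n)) P)

  decode : ℕ → ℕ
  decode v with ceiling ≤? v
  ... | yes _ = v ∸ ceiling
  ... | no _  = (v + h) / n

  decode-block : ∀ {k} x → InRange k → decode (block k x) ≡ k
  decode-block {k} x (d≤k , k<d+m) with ceiling ≤? block k x
  ... | yes above = ⊥-elim (<⇒≱ (block<ceiling x k<d+m) above)
  ... | no _      = block-symbol x (≤-trans 1≤d d≤k)

  decode-beyond : ∀ v → decode (ceiling + v) ≡ v
  decode-beyond v with ceiling ≤? ceiling + v
  ... | yes _     = m+n∸m≡n ceiling v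
  ... | no below  = ⊥-elim (below (m≤m+n ceiling v))

  module Construction (P : ℕ → BlockPattern) (l : Vec ℕ (2 * m)) where

    -- A first occurrence of a symbol k ∈ [d, d + m) is replaced by the first
    -- block of P k, a second occurrence by the second one; any other entry v
    -- becomes ceiling + v, which cannot collide with a block but still records v.
    entry : Fin (2 * m) → Fin n → ℕ
    entry p r with inRange? (lookup l p) | isFirst? l p | isSecond? l p
    ... | yes _ | yes _ | _     = block (lookup l p) (first (P (lookup l p)) r)
    ... | yes _ | no _  | yes _ = block (lookup l p) (second (P (lookup l p)) r)
    ... | _     | _     | _     = ceiling + lookup l p

    blowUp : Vec ℕ (2 * (m * n))
    blowUp = tabulate (uncurry entry ∘ unpos)

    lookup-pos : ∀ p r → lookup blowUp (pos p r) ≡ entry p r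
    lookup-pos p r = trans (lookup∘tabulate _ (pos p r)) (cong (uncurry entry) (unpos-pos p r))

    entry-first : ∀ {p k} r → lookup l p ≡ k → InRange k → IsFirst l p →
                  entry p r ≡ block k (first (P k) r)
    entry-first {p} r refl ir fp with inRange? (lookup l p) | isFirst? l p | isSecond? l p
    ... | yes _   | yes _  | _ = refl
    ... | yes _   | no ¬fp | _ = ⊥-elim (¬fp fp)
    ... | no ¬ir  | _      | _ = ⊥-elim (¬ir ir)

    entry-second : ∀ {p k} r → lookup l p ≡ k → InRange k → ¬ IsFirst l p → IsSecond l p →
                   entry p r ≡ block k (second (P k) r)
    entry-second {p} r refl ir ¬fp sp with inRange? (lookup l p) | isFirst? l p | isSecond? l p
    ... | yes _   | yes fp | _      = ⊥-elim (¬fp fp)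
    ... | yes _   | no _   | yes _  = refl
    ... | yes _   | no _   | no ¬sp = ⊥-elim (¬sp sp)
    ... | no ¬ir  | _      | _      = ⊥-elim (¬ir ir)

    data EntryView (p : Fin (2 * m)) (r : Fin n) : ℕ → Set where
      in-first  : InRange (lookup l p) → IsFirst l p →
                  EntryView p r (block (lookup l p) (first (P (lookup l p)) r))
      in-second : InRange (lookup l p) → IsSecond l p →
                  EntryView p r (block (lookup l p) (second (P (lookup l p)) r))
      beyond    : EntryView p r (ceiling + lookup l p)

    entry-view : ∀ p r → EntryView p r (entry p r)
    entry-view p r with inRange? (lookup l p) | isFirst? l p | isSecond? l p
    ... | yes ir | yes fp | _      = in-first ir fp
    ... | yes ir | no _   | yes sp = in-second ir sp
    ... | yes _  | no _   | no _   = beyond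
    ... | no _   | _      | _      = beyond

    decode-entry : ∀ p r → decode (entry p r) ≡ lookup l p
    decode-entry p r with entry p r | entry-view p r
    ... | _ | in-first ir _  = decode-block _ ir
    ... | _ | in-second ir _ = decode-block _ ir
    ... | _ | beyond         = decode-beyond (lookup l p)

    module Pairs (LP : IsLangford m d l) {k} (ir : InRange k) (t : Fin n) where
      O : Occurrences l k
      O = occurrences LP (proj₁ ir) (proj₂ ir)
      open Occurrences O
      1≤k : 1 ≤ k
      1≤k = ≤-trans 1≤d (proj₁ ir)
      open OccurrenceFacts O 1≤k

      a b : Fin n
      a = proj₁ (realise (P k) t)
      b = proj₁ (proj₂ (realise (P k) t))

      first-a : first (P k) a ≡ t
      first-a = proj₁ (proj₂ (proj₂ (realise (P k) t)))

      second-b : second (P k) b ≡ t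
      second-b = proj₁ (proj₂ (proj₂ (proj₂ (realise (P k) t))))

      b+h≡a+t : toℕ b + h ≡ toℕ a + toℕ t
      b+h≡a+t = proj₂ (proj₂ (proj₂ (proj₂ (realise (P k) t))))

      I J : Fin (2 * (m * n))
      I = pos left a
      J = pos right b

      lookup-I : lookup blowUp I ≡ block k t
      lookup-I = trans (lookup-pos left a) (trans (entry-first a at-left ir left-isFirst) (cong (block k) first-a))

      lookup-J : lookup blowUp J ≡ block k t
      lookup-J = trans (lookup-pos right b)
                   (trans (entry-second b at-right ir right-notFirst right-isSecond) (cong (block k) second-b))

      J-distance : toℕ J ≡ toℕ I + block k t
      J-distance = begin
        toℕ (pos right b)                 ≡⟨ toℕ-pos right b ⟩
        n * toℕ right + toℕ b             ≡⟨ cong (λ j → n * j + toℕ b) distance ⟩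
        n * (toℕ left + k) + toℕ b        ≡⟨ block-distance (toℕ left) a b t 1≤k b+h≡a+t ⟩
        n * toℕ left + toℕ a + block k t  ≡⟨ cong (_+ block k t) (toℕ-pos left a) ⟨
        toℕ (pos left a) + block k t      ∎
        where open ≡-Reasoning

      I≢J : ¬ I ≡ J
      I≢J I≡J = <-irrefl refl (begin-strict
        toℕ I              <⟨ m<m+n (toℕ I) (block-positive t 1≤k) ⟩
        toℕ I + block k t  ≡⟨ J-distance ⟨
        toℕ J              ≡⟨ cong toℕ I≡J ⟨
        toℕ I              ∎)
        where open ≤-Reasoning

      entry-only : ∀ p r → entry p r ≡ block k t → (p ≡ left × r ≡ a) ⊎ (p ≡ right × r ≡ b)
      entry-only p r e with entry p r | entry-view p r
      ... | _ | in-first ir′ fp with block-injective (≤-trans 1≤d (proj₁ ir′)) 1≤k e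
      ...   | refl , offset = inj₁ (isFirst⇒left p refl fp , first-injective (P k) (trans offset (sym first-a)))
      entry-only p r e | _ | in-second ir′ sp with block-injective (≤-trans 1≤d (proj₁ ir′)) 1≤k e
      ...   | refl , offset = inj₂ (isSecond⇒right p refl sp , second-injective (P k) (trans offset (sym second-b)))
      entry-only p r e | _ | beyond =
        ⊥-elim (<-irrefl (sym e) (<-≤-trans (block<ceiling t (proj₂ ir)) (m≤m+n ceiling (lookup l p))))

      only-IJ : ∀ Q → lookup blowUp Q ≡ block k t → Q ≡ I ⊎ Q ≡ J
      only-IJ Q e with entry-only (proj₁ (unpos Q)) (proj₂ (unpos Q)) (trans (sym (lookup-pos _ _)) (trans (cong (lookup blowUp) (pos-unpos Q)) e))
      ... | inj₁ (p≡left , r≡a)  = inj₁ (trans (sym (pos-unpos Q)) (cong₂ pos p≡left r≡a))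
      ... | inj₂ (p≡right , r≡b) = inj₂ (trans (sym (pos-unpos Q)) (cong₂ pos p≡right r≡b))

    blowUp-isLangford : IsLangford m d l → IsLangford (m * n) D′ blowUp
    blowUp-isLangford LP K lo hi with block-cover {m = m} 1≤d lo hi
    ... | k , t , d≤k , k<d+m , refl = I , J , I≢J , lookup-I , lookup-J , J-distance , only-IJ
      where open Pairs LP (d≤k , k<d+m) t

  open Construction public using (blowUp; blowUp-isLangford)
  open Construction using (entry; lookup-pos; decode-entry; entry-first)

  blowUp-sequence : ∀ P P′ l l′ → blowUp P l ≡ blowUp P′ l′ → l ≡ l′
  blowUp-sequence P P′ l l′ e = lookup-extensional l l′ λ p → begin
    lookup l p                                    ≡⟨ decode-entry P l p fzero ⟨
    decode (entry P l p fzero)            ≡⟨ cong decode (lookup-pos P l p fzero) ⟨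
    decode (lookup (blowUp P l) (pos p _))        ≡⟨ cong (λ v → decode (lookup v (pos p fzero))) e ⟩
    decode (lookup (blowUp P′ l′) (pos p _))      ≡⟨ cong decode (lookup-pos P′ l′ p fzero) ⟩
    decode (entry P′ l′ p fzero)          ≡⟨ decode-entry P′ l′ p fzero ⟩
    lookup l′ p                                   ∎
    where open ≡-Reasoning

  blowUp-patterns : ∀ P P′ l → IsLangford m d l → blowUp P l ≡ blowUp P′ l →
                    ∀ {k} → InRange k → ∀ r → first (P k) r ≡ first (P′ k) r
  blowUp-patterns P P′ l LP e {k} ir r = toℕ-injective (+-cancelˡ-≡ (n * k ∸ h) _ _ (begin
    block k (first (P k) r)           ≡⟨ entry-first P l r at-left ir left-isFirst ⟨
    entry P l left r                  ≡⟨ lookup-pos P l left r ⟨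
    lookup (blowUp P l) (pos left r)  ≡⟨ cong (λ v → lookup v (pos left r)) e ⟩
    lookup (blowUp P′ l) (pos left r) ≡⟨ lookup-pos P′ l left r ⟩
    entry P′ l left r                 ≡⟨ entry-first P′ l r at-left ir left-isFirst ⟩
    block k (first (P′ k) r)          ∎))
    where
    open ≡-Reasoning
    O : Occurrences l k
    O = occurrences LP (proj₁ ir) (proj₂ ir)
    open Occurrences O
    open OccurrenceFacts O (≤-trans 1≤d (proj₁ ir))

module SemPattern (h : ℕ) where
  open Blocks h

  arc? : ∀ (A : Vec (Vec Bool n) n) u v → Dec (Arc A u v)
  arc? A u v = lookup (lookup A u) v ≟ᵇ true

  -- The successor and predecessor maps of a 1-regular digraph, found by search,
  -- so that an irrelevant proof of the defining properties suffices.
  module Successor (A : Vec (Vec Bool n) n) .(S : IsSEM1Reg n A) where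
    out-arc : ∀ u → ∃[ v ] Arc A u v
    out-arc u = recompute (any? (arc? A u)) (proj₁ (proj₁ S u) , proj₁ (proj₂ (proj₁ S u)))

    in-arc : ∀ v → ∃[ u ] Arc A u v
    in-arc v = recompute (any? λ u → arc? A u v) (proj₁ (proj₁ (proj₂ S) v) , proj₁ (proj₂ (proj₁ (proj₂ S) v)))

    succ pred : Fin n → Fin n
    succ u = proj₁ (out-arc u)
    pred v = proj₁ (in-arc v)

    succ-arc : ∀ u → Arc A u (succ u)
    succ-arc u = proj₂ (out-arc u)

    pred-arc : ∀ v → Arc A (pred v) v
    pred-arc v = proj₂ (in-arc v)

    -- the label sum of the arc leaving u, shifted down by the magic constant h + 2
    offset : Fin n → Fin n
    offset u = (arcSum u (succ u) ∸ suc (suc h)) mod n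

  module Facts (A : Vec (Vec Bool n) n) (S : IsSEM1Reg n A) where
    open Successor A S public

    succ-unique : ∀ {u v} → Arc A u v → v ≡ succ u
    succ-unique {u} a = trans (proj₂ (proj₂ (proj₁ S u)) _ a) (sym (proj₂ (proj₂ (proj₁ S u)) _ (succ-arc u)))

    pred-unique : ∀ {u v} → Arc A u v → u ≡ pred v
    pred-unique {v = v} a = trans (proj₂ (proj₂ (proj₁ (proj₂ S) v)) _ a)
                                  (sym (proj₂ (proj₂ (proj₁ (proj₂ S) v)) _ (pred-arc v)))

    pred-succ : ∀ u → pred (succ u) ≡ u
    pred-succ u = sym (pred-unique (succ-arc u))

    succ-pred : ∀ v → succ (pred v) ≡ v
    succ-pred v = sym (succ-unique (pred-arc v))

    s : ℕ
    s = proj₁ (proj₂ (proj₂ (proj₂ S)))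

    sum-range : ∀ u → s ≤ arcSum u (succ u) × arcSum u (succ u) < s + n
    sum-range u = proj₁ (proj₂ (proj₂ (proj₂ (proj₂ S)))) u (succ u) (succ-arc u)

    sum-attained : ∀ t → s ≤ t → t < s + n → ∃[ u ] ∃[ v ] (Arc A u v × arcSum u v ≡ t)
    sum-attained = proj₂ (proj₂ (proj₂ (proj₂ (proj₂ S))))

    arcSum-injective : ∀ {u u′} → arcSum u (succ u) ≡ arcSum u′ (succ u′) → u ≡ u′
    arcSum-injective e = proj₁ (proj₁ (proj₂ (proj₂ S)) _ _ _ _ (succ-arc _) (succ-arc _) e)

    rank : Fin n → Fin n
    rank u = fromℕ< (+-cancelˡ-< s _ _ (subst (_< s + n) (sym (m+[n∸m]≡n (proj₁ (sum-range u)))) (proj₂ (sum-range u))))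

    arcSum-rank : ∀ u → arcSum u (succ u) ≡ s + toℕ (rank u)
    arcSum-rank u = trans (sym (m+[n∸m]≡n (proj₁ (sum-range u)))) (cong (s +_) (sym (toℕ-fromℕ< _)))

    unrank : Fin n → Fin n
    unrank t = proj₁ (sum-attained (s + toℕ t) (m≤m+n s (toℕ t)) (+-monoʳ-< s (toℕ<n t)))

    arcSum-unrank : ∀ t → arcSum (unrank t) (succ (unrank t)) ≡ s + toℕ t
    arcSum-unrank t with sum-attained (s + toℕ t) (m≤m+n s (toℕ t)) (+-monoʳ-< s (toℕ<n t))
    ... | u , v , a , e = trans (cong (arcSum u) (sym (succ-unique a))) e

    rank-unrank : ∀ t → rank (unrank t) ≡ t
    rank-unrank t = toℕ-injective (+-cancelˡ-≡ s _ _ (trans (sym (arcSum-rank (unrank t))) (arcSum-unrank t)))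

    unrank-rank : ∀ u → unrank (rank u) ≡ u
    unrank-rank u = arcSum-injective (trans (arcSum-unrank (rank u)) (sym (arcSum-rank u)))

    -- Summing the arc label sums once as  s + rank u  and once as
    -- (u + 1) + (succ u + 1), using that rank and succ permute the vertices,
    -- gives  n s + Σ u = 2n + 2 Σ u  with  Σ u = n h; hence s = h + 2.
    magic-constant : s ≡ suc (suc h)
    magic-constant = *-cancelˡ-≡ s (suc (suc h)) n (+-cancelʳ-≡ Σi _ _ (begin
      n * s + Σi                 ≡⟨ by-rank ⟨
      total                      ≡⟨ by-ends ⟩
      n * 2 + Σi + Σi            ≡⟨ cong (λ x → n * 2 + x + Σi) Σi≡n*h ⟩
      n * 2 + n * h + Σi         ≡⟨ cong (_+ Σi) (*-distribˡ-+ n 2 h) ⟨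
      n * suc (suc h) + Σi       ∎))
      where
      open ≡-Reasoning
      Σi total : ℕ
      Σi = sum {n} toℕ
      total = sum {n} (λ u → arcSum u (succ u))

      Σi≡n*h : Σi ≡ n * h
      Σi≡n*h = *-cancelˡ-≡ Σi (n * h) 2 (trans (sum-toℕ (2 * h)) (swap n h))
        where
        swap : ∀ n h → n * (2 * h) ≡ 2 * (n * h)
        swap = solve-∀

      by-rank : total ≡ n * s + Σi
      by-rank = begin
        total                                ≡⟨ sum-cong-≗ arcSum-rank ⟩
        sum {n} (λ u → s + toℕ (rank u))     ≡⟨ ∑-distrib-+ {n} (λ _ → s) (toℕ ∘ rank) ⟩
        sum {n} (λ _ → s) + sum (toℕ ∘ rank) ≡⟨ cong₂ _+_ (sum-const n s) (sym (sum-permute toℕ ranking)) ⟩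
        n * s + Σi                           ∎
        where
        ranking : Permutation n n
        ranking = permutation rank unrank rank-unrank unrank-rank

      by-ends : total ≡ n * 2 + Σi + Σi
      by-ends = begin
        total                                               ≡⟨ sum-cong-≗ (λ u → regroup (toℕ u) (toℕ (succ u))) ⟩
        sum {n} (λ u → 2 + (toℕ u + toℕ (succ u)))          ≡⟨ ∑-distrib-+ {n} (λ _ → 2) (λ u → toℕ u + toℕ (succ u)) ⟩
        sum {n} (λ _ → 2) + sum (λ u → toℕ u + toℕ (succ u)) ≡⟨ cong₂ _+_ (sum-const n 2) (∑-distrib-+ {n} toℕ (toℕ ∘ succ)) ⟩
        n * 2 + (Σi + sum (toℕ ∘ succ))                     ≡⟨ cong (λ x → n * 2 + (Σi + x)) (sum-permute toℕ successor) ⟨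
        n * 2 + (Σi + Σi)                                   ≡⟨ +-assoc (n * 2) Σi Σi ⟨
        n * 2 + Σi + Σi                                     ∎
        where
        successor : Permutation n n
        successor = permutation succ pred succ-pred pred-succ
        regroup : ∀ x y → (x + 1) + (y + 1) ≡ 2 + (x + y)
        regroup = solve-∀

    offset-rank : ∀ u → offset u ≡ rank u
    offset-rank u = toℕ-injective (begin
      toℕ (offset u)                               ≡⟨ toℕ-fromℕ< _ ⟩
      (arcSum u (succ u) ∸ suc (suc h)) % n ≡⟨ cong (_% n) shifted ⟩
      toℕ (rank u) % n                    ≡⟨ m<n⇒m%n≡m (toℕ<n (rank u)) ⟩
      toℕ (rank u)                                 ∎)
      where
      open ≡-Reasoning
      shifted : arcSum u (succ u) ∸ suc (suc h) ≡ toℕ (rank u)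
      shifted = trans (cong₂ _∸_ (arcSum-rank u) (sym magic-constant)) (m+n∸m≡n s (toℕ (rank u)))

    offset-spec : ∀ u → arcSum u (succ u) ≡ suc (suc h) + toℕ (offset u)
    offset-spec u = trans (arcSum-rank u) (cong₂ _+_ magic-constant (cong toℕ (sym (offset-rank u))))

    offset-injective : ∀ {u u′} → offset u ≡ offset u′ → u ≡ u′
    offset-injective {u} {u′} e = arcSum-injective (trans (offset-spec u) (trans (cong (λ t → suc (suc h) + toℕ t) e) (sym (offset-spec u′))))

    -- the pattern of the digraph reads the offsets in reverse vertex order in
    -- the first block and along the predecessor map in the second: the offset
    -- t = offset u appears at a = 2h - u and at b = succ u, and b + h = a + t
    -- because  (u + 1) + (succ u + 1) = h + 2 + t
    realise : ∀ t → Σ (Fin n) λ a → Σ (Fin n) λ b →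
              offset (opposite a) ≡ t × offset (pred b) ≡ t × toℕ b + h ≡ toℕ a + toℕ t
    realise t = opposite u , succ u , first-ok , second-ok , distance
      where
      u : Fin n
      u = unrank t
      offset-u : offset u ≡ t
      offset-u = trans (offset-rank u) (rank-unrank t)
      first-ok : offset (opposite (opposite u)) ≡ t
      first-ok = trans (cong offset (opposite-involutive u)) offset-u
      second-ok : offset (pred (succ u)) ≡ t
      second-ok = trans (cong offset (pred-succ u)) offset-u
      distance : toℕ (succ u) + h ≡ toℕ (opposite u) + toℕ t
      distance = trans (solve-for-succ (toℕ u) (toℕ (succ u)) (toℕ t) (toℕ≤pred[n] u)
                          (trans (offset-spec u) (cong (λ x → suc (suc h) + toℕ x) offset-u)))
                       (cong (_+ toℕ t) (sym (opposite-prop u)))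
        where
        solve-for-succ : ∀ x y t → x ≤ 2 * h → (x + 1) + (y + 1) ≡ suc (suc h) + t → y + h ≡ (2 * h ∸ x) + t
        solve-for-succ x y t x≤2h e = +-cancelʳ-≡ (x + 2) _ _ (begin
          y + h + (x + 2)             ≡⟨ regroup₁ x y h ⟩
          (x + 1) + (y + 1) + h       ≡⟨ cong (_+ h) e ⟩
          suc (suc h) + t + h         ≡⟨ regroup₂ h t ⟩
          2 * h + t + 2               ≡⟨ cong (λ z → z + t + 2) (m∸n+n≡m x≤2h) ⟨
          2 * h ∸ x + x + t + 2       ≡⟨ regroup₃ (2 * h ∸ x) x t ⟩
          2 * h ∸ x + t + (x + 2)     ∎)
          where
          open ≡-Reasoning
          regroup₁ : ∀ x y h → y + h + (x + 2) ≡ (x + 1) + (y + 1) + h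
          regroup₁ = solve-∀
          regroup₂ : ∀ h t → suc (suc h) + t + h ≡ 2 * h + t + 2
          regroup₂ = solve-∀
          regroup₃ : ∀ z x t → z + x + t + 2 ≡ z + t + (x + 2)
          regroup₃ = solve-∀

  open BlockPattern

  -- digraphs with the same offsets have the same successor map, hence the same arcs
  same-offsets⇒same-adjacency : ∀ A A′ (S : IsSEM1Reg n A) (S′ : IsSEM1Reg n A′) →
    (∀ u → Successor.offset A S u ≡ Successor.offset A′ S′ u) → A ≡ A′
  same-offsets⇒same-adjacency A A′ S S′ same =
    lookup-extensional A A′ λ u → lookup-extensional _ _ λ v →
      bool-ext _ _ (arc⇒arc′ u v) (arc′⇒arc u v)
    where
    module F = Facts A S
    module F′ = Facts A′ S′
    same-succ : ∀ u → F′.succ u ≡ F.succ u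
    same-succ u = toℕ-injective (+-cancelʳ-≡ 1 _ _ (+-cancelˡ-≡ (toℕ u + 1) _ _ (begin
      arcSum u (F′.succ u)                     ≡⟨ F′.offset-spec u ⟩
      suc (suc h) + toℕ (F′.offset u)          ≡⟨ cong (λ t → suc (suc h) + toℕ t) (same u) ⟨
      suc (suc h) + toℕ (F.offset u)           ≡⟨ F.offset-spec u ⟨
      arcSum u (F.succ u)                      ∎)))
      where open ≡-Reasoning
    arc⇒arc′ : ∀ u v → Arc A u v → Arc A′ u v
    arc⇒arc′ u v a = subst (Arc A′ u) (trans (same-succ u) (sym (F.succ-unique a))) (F′.succ-arc u)
    arc′⇒arc : ∀ u v → Arc A′ u v → Arc A u v
    arc′⇒arc u v a = subst (Arc A u) (trans (sym (same-succ u)) (sym (F′.succ-unique a))) (F.succ-arc u)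

  sem-pattern : SEM n → BlockPattern
  sem-pattern (mkSEM A S) = record
    { first            = offset ∘ opposite
    ; second           = offset ∘ pred
    ; first-injective  = λ {r} {r′} e → recompute (r ≟ᶠ r′)
        (left-inverse⇒injective {f = opposite} opposite opposite-involutive (Facts.offset-injective A S e))
    ; second-injective = λ {r} {r′} e → recompute (r ≟ᶠ r′)
        (left-inverse⇒injective {f = pred} succ (Facts.succ-pred A S) (Facts.offset-injective A S e))
    ; realise          = λ t → recompute (realisable? t) (Facts.realise A S t)
    }
    where
    open Successor A S
    realisable? : ∀ t → Dec (Σ (Fin n) λ a → Σ (Fin n) λ b →
                    offset (opposite a) ≡ t × offset (pred b) ≡ t × toℕ b + h ≡ toℕ a + toℕ t)
    realisable? t = any? λ a → any? λ b →
      (offset (opposite a) ≟ᶠ t) ×-dec ((offset (pred b) ≟ᶠ t) ×-dec (toℕ b + h ≟ toℕ a + toℕ t))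

  sem-pattern-injective : ∀ S S′ → (∀ r → first (sem-pattern S) r ≡ first (sem-pattern S′) r) → S ≡ S′
  sem-pattern-injective (mkSEM A S) (mkSEM A′ S′) same-first =
    same-adjacency (recompute (≡-dec (≡-dec _≟ᵇ_) A A′) (same-offsets⇒same-adjacency A A′ S S′ same-offset))
    where
    same-offset : ∀ u → Successor.offset A S u ≡ Successor.offset A′ S′ u
    same-offset u = subst (λ v → Successor.offset A S v ≡ Successor.offset A′ S′ v)
                          (opposite-involutive u) (same-first (opposite u))
    same-adjacency : A ≡ A′ → mkSEM A S ≡ mkSEM A′ S′
    same-adjacency refl = refl

-- The product of m digraphs of order n = 2h+1 with a Langford sequence of
-- order m and defect d; m ≥ 1 lets every symbol choose a digraph.
module Product (h m d : ℕ) (1≤m : 1 ≤ m) (1≤d : 1 ≤ d) where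
  open Blocks h
  open BlockPattern
  open BlowUp h m d 1≤d
  open SemPattern h

  instance
    m-nonZero : NonZero m
    m-nonZero = >-nonZero 1≤m

  patterns : (Fin m → SEM n) → ℕ → BlockPattern
  patterns Ss k = sem-pattern (Ss ((k ∸ d) mod m))

  patterns-slot : ∀ Ss (q : Fin m) → patterns Ss (d + toℕ q) ≡ sem-pattern (Ss q)
  patterns-slot Ss q = cong (sem-pattern ∘ Ss) (toℕ-injective (begin
    toℕ ((d + toℕ q ∸ d) mod m)   ≡⟨ toℕ-fromℕ< _ ⟩
    (d + toℕ q ∸ d) % m           ≡⟨ cong (_% m) (m+n∸m≡n d (toℕ q)) ⟩
    toℕ q % m                     ≡⟨ m<n⇒m%n≡m (toℕ<n q) ⟩
    toℕ q                         ∎))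
    where open ≡-Reasoning

  product : (Fin m → SEM n) → Langford m d → Langford (m * n) D′
  product Ss (mkLangford l L) = mkLangford (blowUp (patterns Ss) l) (blowUp-isLangford (patterns Ss) l L)

  -- the product is injective because the blow-up determines the sequence and
  -- the patterns, and a pattern determines its digraph
  product-injective : ∀ Ss Ss′ L L′ → product Ss L ≡ product Ss′ L′ → (∀ q → Ss q ≡ Ss′ q) × L ≡ L′
  product-injective Ss Ss′ (mkLangford l L) (mkLangford l′ _) e
    with blowUp-sequence (patterns Ss) (patterns Ss′) l l′ (cong Langford.seq e)
  ... | refl = (λ q → sem-pattern-injective (Ss q) (Ss′ q) (same-first q)) , refl
    where
    same-first : ∀ q r → first (sem-pattern (Ss q)) r ≡ first (sem-pattern (Ss′ q)) r
    same-first q r = recompute (_ ≟ᶠ _)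
      (subst₂ (λ P P′ → first P r ≡ first P′ r) (patterns-slot Ss q) (patterns-slot Ss′ q)
        (blowUp-patterns (patterns Ss) (patterns Ss′) l L (cong Langford.seq e) (m≤m+n d (toℕ q) , +-monoʳ-< d (toℕ<n q)) r))

  product-bound : ∀ {a b c} → Fin a ↔ Langford (m * n) D′ → Fin b ↔ SEM n → Fin c ↔ Langford m d →
                  b ^ m * c ≤ a
  product-bound ia ib ic = count-by-injection ia ib ic product product-injective

odd-half : ∀ n → n % 2 ≡ 1 → n ≡ suc (2 * (n / 2)) × (n ∸ 1) / 2 ≡ n / 2
odd-half n odd = n≡2h+1 , (begin
  (n ∸ 1) / 2                   ≡⟨ cong (λ x → (x ∸ 1) / 2) n≡2h+1 ⟩
  (2 * (n / 2)) / 2             ≡⟨ cong (_/ 2) (*-comm 2 (n / 2)) ⟩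
  (n / 2) * 2 / 2               ≡⟨ m*n/n≡m (n / 2) 2 ⟩
  n / 2                         ∎)
  where
  open ≡-Reasoning
  n≡2h+1 : n ≡ suc (2 * (n / 2))
  n≡2h+1 = trans (m≡m%n+[m/n]*n n 2) (cong₂ _+_ odd (*-comm (n / 2) 2))

theorem3p3 : (m n d : ℕ) → 1 ≤ m → 1 ≤ n → 1 ≤ d → n % 2 ≡ 1 →
    ∀ (a b c : ℕ) →
    Fin a ↔ Langford (m * n) (n * d ∸ (n ∸ 1) / 2) →
    Fin b ↔ SEM n →
    Fin c ↔ Langford m d →
    b ^ m * c ≤ a
theorem3p3 m n d 1≤m _ 1≤d n-odd a b c ia ib ic =
  bound n≡2h+1 (subst (λ x → Fin a ↔ Langford (m * n) (n * d ∸ x)) half≡h ia) ib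
  where
  h : ℕ
  h = n / 2
  n≡2h+1 : n ≡ suc (2 * h)
  n≡2h+1 = proj₁ (odd-half n n-odd)
  half≡h : (n ∸ 1) / 2 ≡ h
  half≡h = proj₂ (odd-half n n-odd)
  bound : ∀ {n′} → n′ ≡ suc (2 * h) → Fin a ↔ Langford (m * n′) (n′ * d ∸ h) → Fin b ↔ SEM n′ → b ^ m * c ≤ a
  bound refl ia′ ib′ = Product.product-bound h m d 1≤m 1≤d ia′ ib′ ic
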